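{- Consider the BML dynamics with $m$ cars on $\mathbb{Z}_N\times\mathbb{Z}_N$, and for each time $t\ge 0$ let $S_t=\{Y^1_t,\dots,Y^m_t\}\subseteq\mathbb{Z}_N$. Then the number of maximal empty arcs of $\mathbb{Z}_N\setminus S_t$ containing at least two points is a non-increasing function of $t$.
   Context: Write $\mathbb{Z}_N=\mathbb{Z}/N\mathbb{Z}$ and consider the torus $\mathbb{Z}_N\times\mathbb{Z}_N$; the first coordinate points vertically ("up" means increasing the first coordinate) and the second horizontally ("right" means increasing the second coordinate). A configuration consists of $m<N^2$ cars at distinct sites, each coloured red or blue. Each time step consists of two sub-steps. First all blue cars try to move simultaneously one step right: a blue car at $(i,j)$ fails to move if and only if for some $k\ge 0$ the sites $(i,j+1),\dots,(i,j+k)$ hold blue cars and $(i,j+k+1)$ holds a red car; all other blue cars move one step right. Then, in the resulting configuration, all red cars try to move simultaneously one step up: a red car at $(i,j)$ fails to move if and only if for some $k\ge0$ the sites $(i+1,j),\dots,(i+k,j)$ hold red cars and $(i+k+1,j)$ holds a blue car; all other red cars move one step up. Let $X^i_t$ be the position of car $i$ at time $t$, and define $\phi_t:\mathbb{Z}_N^2\to\mathbb{Z}_N$ by $\phi_t(a,b)=a+b-t \bmod N$ and $Y^i_t=\phi_t(X^i_t)$. A maximal empty arc at time $t$ is a set $\{y,y+1,\dots,y+l\}\subseteq\mathbb{Z}_N\setminus S_t$ of consecutive points (mod $N$) such that $y-1\in S_t$ and $y+l+1\in S_t$. -}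

module Defs where

open import Data.Nat using (ℕ; zero; suc; _+_; _*_; _∸_; _≤_; _<_; NonZero)
open import Data.Nat.DivMod using (_mod_)
open import Data.Fin using (Fin; toℕ)
open import Data.Fin.Properties using (any?; all?)
import Data.Fin.Properties as FinP
open import Data.Product using (Σ; ∃; _×_; _,_; proj₁; proj₂)
open import Data.Product.Properties using (≡-dec)
open import Data.List using (List; length; filter; cartesianProduct; allFin; upTo)
open import Relation.Nullary using (¬_; Dec; yes; no)
open import Relation.Nullary.Decidable using (_×-dec_; ¬?)
open import Relation.Binary.PropositionalEquality using (_≡_)

-- Cells of the torus Z_N × Z_N : (first = vertical, second = horizontal)
Pos : ℕ → Set
Pos N = Fin N × Fin N

data Colour : Set where
  red blue : Colour

module _ (N : ℕ) .{{_ : NonZero N}} where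

  _⊕_ : Fin N → ℕ → Fin N
  a ⊕ k = (toℕ a + k) mod N

  pred′ : Fin N → Fin N
  pred′ a = (toℕ a + (N ∸ 1)) mod N

  right : Pos N → ℕ → Pos N
  right (a , b) k = (a , b ⊕ k)

  up : Pos N → ℕ → Pos N
  up (a , b) k = (a ⊕ k , b)

  module _ {m : ℕ} (col : Fin m → Colour) where

    HasAt : (pos : Fin m → Pos N) → Colour → Pos N → Set
    HasAt pos c p = ∃ λ i → col i ≡ c × pos i ≡ p

    BlueBlocked : (Fin m → Pos N) → Pos N → Set
    BlueBlocked pos p = ∃ λ k →
      (∀ j → j < k → HasAt pos blue (right p (suc j))) × HasAt pos red (right p (suc k))

    RedBlocked : (Fin m → Pos N) → Pos N → Set
    RedBlocked pos p = ∃ λ k →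
      (∀ j → j < k → HasAt pos red (up p (suc j))) × HasAt pos blue (up p (suc k))

    BlueStep : (pos pos′ : Fin m → Pos N) → Set
    BlueStep pos pos′ = ∀ i →
      (col i ≡ red → pos′ i ≡ pos i) ×
      (col i ≡ blue → (BlueBlocked pos (pos i) → pos′ i ≡ pos i)
                    × (¬ BlueBlocked pos (pos i) → pos′ i ≡ right (pos i) 1))

    RedStep : (pos pos′ : Fin m → Pos N) → Set
    RedStep pos pos′ = ∀ i →
      (col i ≡ blue → pos′ i ≡ pos i) ×
      (col i ≡ red → (RedBlocked pos (pos i) → pos′ i ≡ pos i)
                   × (¬ RedBlocked pos (pos i) → pos′ i ≡ up (pos i) 1))

    IsTrajectory : (ℕ → Fin m → Pos N) → Set
    IsTrajectory X = ∀ t → ∃ λ Z → BlueStep (X t) Z × RedStep Z (X (suc t))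

  -- φ_t(a,b) = a + b - t mod N, computed as a + b + t(N-1) mod N
  φ : ℕ → Pos N → Fin N
  φ t (a , b) = (toℕ a + toℕ b + t * (N ∸ 1)) mod N

  Ys : {m : ℕ} → (ℕ → Fin m → Pos N) → ℕ → Fin m → Fin N
  Ys X t i = φ t (X t i)

  module _ {m : ℕ} (Y : Fin m → Fin N) where

    InS : Fin N → Set
    InS y = ∃ λ i → Y i ≡ y

    InS? : ∀ y → Dec (InS y)
    InS? y = any? (λ i → Y i FinP.≟ y)

    MaxArc : Fin N → ℕ → Set
    MaxArc y l = (∀ (j : Fin (suc l)) → ¬ InS (y ⊕ toℕ j))
               × InS (pred′ y) × InS (y ⊕ suc l)

    MaxArc? : ∀ y l → Dec (MaxArc y l)
    MaxArc? y l = all? (λ j → ¬? (InS? (y ⊕ toℕ j)))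
                  ×-dec (InS? (pred′ y) ×-dec InS? (y ⊕ suc l))

    BigArc : Fin N × ℕ → Set
    BigArc (y , l) = 1 ≤ l × MaxArc y l

    BigArc? : ∀ p → Dec (BigArc p)
    BigArc? (y , l) = (1 Data.Nat.≤? l) ×-dec MaxArc? y l

    -- number of maximal empty arcs with ≥ 2 points.  An arc {y..y+l} is
    -- identified by its start y (the unique element with y-1 ∈ S); l < N always.
    numBigArcs : ℕ
    numBigArcs = length (filter BigArc? (cartesianProduct (allFin N) (upTo N)))

{-# OPTIONS --safe #-}

-- Along φ_t a car that moves keeps its label Y, while a car that stays has its label lowered by
-- one; a car stays only if the site ahead of it was occupied at time t, or (a red car facing a
-- blue car that has just moved in) if its own label is occupied at time t + 1. Hence every label
-- at time t + 1 is a label at time t or its predecessor, and a label vacated between t and t + 1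
-- has its successor occupied at time t and its predecessor at time t + 1. So if {y, …, y + l},
-- l ≥ 1, is a maximal empty arc at time t + 1, it contains no label of time t while y - 1 is one:
-- the maximal empty arc at time t starting at y is at least as long. As an arc is determined by
-- its first point, the arcs with at least two points at time t + 1 inject into those at time t.
module Submission where

open import Defs
open import Data.Nat using (ℕ; zero; suc; _+_; _*_; _∸_; _≤_; _<_; _≤′_; ≤′-refl; ≤′-step; z≤n; s≤s; NonZero)
open import Data.Nat.Properties
open import Data.Nat.DivMod using (_%_; _mod_; m%n<n; %-distribˡ-+; m%n%n≡m%n; [m+n]%n≡m%n; m<n⇒m%n≡m)
open import Data.Nat.Tactic.RingSolver using (solve-∀)
open import Data.Fin using (Fin; toℕ; fromℕ<)
open import Data.Fin.Properties using (toℕ-fromℕ<; fromℕ<-toℕ; fromℕ<-cong; toℕ<n)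
open import Data.Product using (∃; _×_; _,_; proj₁; proj₂)
open import Data.Sum using (_⊎_; inj₁; inj₂; [_,_]′)
open import Data.List using (List; []; _∷_; _++_; length; filter; map; cartesianProduct; allFin; upTo)
open import Data.List.Properties using (filter-none; filter-some; filter-++; length-++)
open import Data.List.Relation.Unary.Any using (Any; any?; satisfied)
open import Data.List.Relation.Unary.All as All using ()
open import Data.List.Relation.Unary.All.Properties using (¬Any⇒All¬)
open import Data.List.Relation.Unary.AllPairs using (_∷_)
open import Data.List.Relation.Unary.Unique.Propositional using (Unique)
open import Data.List.Relation.Unary.Unique.Propositional.Properties using (upTo⁺)
open import Data.List.Membership.Propositional using (lose)
open import Data.List.Membership.Propositional.Properties using (∈-upTo⁺)
open import Function using (_∘_)
open import Function.Definitions using (Injective)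
open import Relation.Nullary using (¬_; Dec; yes; no; contradiction)
open import Relation.Nullary.Decidable using (_×-dec_; _⊎-dec_; decidable-stable; ¬¬-excluded-middle)
open import Relation.Nullary.Negation using (¬¬-map)
open import Relation.Unary using (Pred; Decidable)
open import Relation.Binary.Definitions using (tri<; tri≈; tri>)
open import Relation.Binary.PropositionalEquality

least-witness : ∀ {p} {P : Pred ℕ p} → Decidable P → ∀ {n} → P n →
                ∃ λ k → k ≤ n × P k × (∀ {j} → j < k → ¬ P j)
least-witness {P = P} P? {n} Pn = search n 0 (+-identityʳ n) (λ ())
  where
  search : ∀ d k → d + k ≡ n → (∀ {j} → j < k → ¬ P j) →
           ∃ λ k′ → k′ ≤ n × P k′ × (∀ {j} → j < k′ → ¬ P j)
  search d k d+k≡n below with P? k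
  ... | yes Pk = k , subst (k ≤_) d+k≡n (m≤n+m k d) , Pk , below
  search zero    k k≡n    below | no ¬Pk = contradiction (subst P (sym k≡n) Pn) ¬Pk
  search (suc d) k d+k≡n below | no ¬Pk =
    search d (suc k) (trans (+-suc d k) d+k≡n)
      (λ j<1+k → [ below , (λ { refl → ¬Pk }) ]′ (m<1+n⇒m<n∨m≡n j<1+k))

antitone-from-steps : (f : ℕ → ℕ) → (∀ t → f (suc t) ≤ f t) → ∀ {s t} → s ≤ t → f t ≤ f s
antitone-from-steps f step s≤t = go (≤⇒≤′ s≤t)
  where
  go : ∀ {s t} → s ≤′ t → f t ≤ f s
  go ≤′-refl        = ≤-refl
  go (≤′-step s≤′t) = ≤-trans (step _) (go s≤′t)

module _ {a p q} {A : Set a} {P : Pred A p} {Q : Pred A q} (P? : Decidable P) (Q? : Decidable Q) where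

  length-filter-≤1 : ∀ {xs} → Unique xs → (∀ {x y} → P x → P y → x ≡ y) →
                     length (filter P? xs) ≤ 1
  length-filter-≤1 {[]}     _          _       = z≤n
  length-filter-≤1 {x ∷ xs} (x∉ ∷ xs!) P-unique with P? x
  ... | yes Px = s≤s (≤-reflexive (cong length
                   (filter-none P? (All.map (λ x≢y Py → x≢y (P-unique Px Py)) x∉))))
  ... | no _   = length-filter-≤1 xs! P-unique

  length-filter-subsingleton-≤ : ∀ {xs} → Unique xs → (∀ {x y} → P x → P y → x ≡ y) →
                                 (∀ {x} → P x → Any Q xs) →
                                 length (filter P? xs) ≤ length (filter Q? xs)
  length-filter-subsingleton-≤ {xs} xs! P-unique P⇒Q with any? P? xs
  ... | yes anyP =
    ≤-trans (length-filter-≤1 xs! P-unique) (filter-some Q? (P⇒Q (proj₂ (satisfied anyP))))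
  ... | no ¬anyP =
    ≤-trans (≤-reflexive (cong length (filter-none P? (¬Any⇒All¬ xs ¬anyP)))) z≤n

module _ {a p} {A : Set a} {P : Pred A p} (P? : Decidable P) where

  length-filter-++ : ∀ xs ys →
                     length (filter P? (xs ++ ys)) ≡ length (filter P? xs) + length (filter P? ys)
  length-filter-++ xs ys = trans (cong length (filter-++ P? xs ys)) (length-++ (filter P? xs))

  length-filter-map : ∀ {b} {B : Set b} (f : B → A) xs →
                      length (filter P? (map f xs)) ≡ length (filter (P? ∘ f) xs)
  length-filter-map f []       = refl
  length-filter-map f (x ∷ xs) with P? (f x)
  ... | yes _ = cong suc (length-filter-map f xs)
  ... | no _  = length-filter-map f xs

length-filter-cartesianProduct-mono :
  ∀ {a b p q} {A : Set a} {B : Set b} {P : Pred (A × B) p} {Q : Pred (A × B) q}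
  (P? : Decidable P) (Q? : Decidable Q) (xs : List A) (ys : List B) →
  (∀ x → length (filter (P? ∘ (x ,_)) ys) ≤ length (filter (Q? ∘ (x ,_)) ys)) →
  length (filter P? (cartesianProduct xs ys)) ≤ length (filter Q? (cartesianProduct xs ys))
length-filter-cartesianProduct-mono P? Q? []       ys P≤Q = z≤n
length-filter-cartesianProduct-mono P? Q? (x ∷ xs) ys P≤Q = begin
  length (filter P? (map (x ,_) ys ++ cartesianProduct xs ys))
    ≡⟨ length-filter-++ P? (map (x ,_) ys) _ ⟩
  length (filter P? (map (x ,_) ys)) + length (filter P? (cartesianProduct xs ys))
    ≡⟨ cong (_+ _) (length-filter-map P? (x ,_) ys) ⟩
  length (filter (P? ∘ (x ,_)) ys) + length (filter P? (cartesianProduct xs ys))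
    ≤⟨ +-mono-≤ (P≤Q x) (length-filter-cartesianProduct-mono P? Q? xs ys P≤Q) ⟩
  length (filter (Q? ∘ (x ,_)) ys) + length (filter Q? (cartesianProduct xs ys))
    ≡⟨ cong (_+ _) (length-filter-map Q? (x ,_) ys) ⟨
  length (filter Q? (map (x ,_) ys)) + length (filter Q? (cartesianProduct xs ys))
    ≡⟨ length-filter-++ Q? (map (x ,_) ys) _ ⟨
  length (filter Q? (map (x ,_) ys ++ cartesianProduct xs ys)) ∎
  where open ≤-Reasoning

module _ {N : ℕ} .{{_ : NonZero N}} where

  infixl 6 _⊞_
  _⊞_ : Fin N → ℕ → Fin N
  _⊞_ = _⊕_ N

  mod-cong : ∀ {x y} → x % N ≡ y % N → x mod N ≡ y mod N
  mod-cong {x} {y} eq = fromℕ<-cong (x % N) (y % N) eq (m%n<n x N) (m%n<n y N)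

  mod-⊞ : ∀ x k → x mod N ⊞ k ≡ (x + k) mod N
  mod-⊞ x k = mod-cong (begin
    (toℕ (x mod N) + k) % N  ≡⟨ cong (λ r → (r + k) % N) (toℕ-fromℕ< (m%n<n x N)) ⟩
    (x % N + k) % N          ≡⟨ %-distribˡ-+ (x % N) k N ⟩
    (x % N % N + k % N) % N  ≡⟨ cong (λ r → (r + k % N) % N) (m%n%n≡m%n x N) ⟩
    (x % N + k % N) % N      ≡⟨ %-distribˡ-+ x k N ⟨
    (x + k) % N              ∎)
    where open ≡-Reasoning

  ⊞-assoc : ∀ y a b → y ⊞ a ⊞ b ≡ y ⊞ (a + b)
  ⊞-assoc y a b = trans (mod-⊞ (toℕ y + a) b) (cong (_mod N) (+-assoc (toℕ y) a b))

  ⊞-identityʳ : ∀ y → y ⊞ 0 ≡ y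
  ⊞-identityʳ y =
    trans (fromℕ<-cong _ _ y+0%N≡y (m%n<n (toℕ y + 0) N) (toℕ<n y)) (fromℕ<-toℕ y (toℕ<n y))
    where
    y+0%N≡y : (toℕ y + 0) % N ≡ toℕ y
    y+0%N≡y = trans (cong (_% N) (+-identityʳ (toℕ y))) (m<n⇒m%n≡m (toℕ<n y))

  ⊞-period : ∀ y a → y ⊞ (a + N) ≡ y ⊞ a
  ⊞-period y a =
    mod-cong (trans (cong (_% N) (sym (+-assoc (toℕ y) a N))) ([m+n]%n≡m%n (toℕ y + a) N))

  pred′-⊞-suc : ∀ y j → pred′ N (y ⊞ suc j) ≡ y ⊞ j
  pred′-⊞-suc y j = begin
    y ⊞ suc j ⊞ (N ∸ 1)    ≡⟨ ⊞-assoc y (suc j) (N ∸ 1) ⟩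
    y ⊞ (suc j + (N ∸ 1))  ≡⟨ cong (y ⊞_) (+-suc j (N ∸ 1)) ⟨
    y ⊞ (j + suc (N ∸ 1))  ≡⟨ cong (λ k → y ⊞ (j + k)) (suc-pred N) ⟩
    y ⊞ (j + N)            ≡⟨ ⊞-period y j ⟩
    y ⊞ j                  ∎
    where open ≡-Reasoning

  pred′-⊞1 : ∀ y → pred′ N (y ⊞ 1) ≡ y
  pred′-⊞1 y = trans (pred′-⊞-suc y 0) (⊞-identityʳ y)

  ⊞1-pred′ : ∀ y → pred′ N y ⊞ 1 ≡ y
  ⊞1-pred′ y = begin
    y ⊞ (N ∸ 1) ⊞ 1    ≡⟨ ⊞-assoc y (N ∸ 1) 1 ⟩
    y ⊞ (N ∸ 1 + 1)    ≡⟨ cong (y ⊞_) (trans (+-comm (N ∸ 1) 1) (suc-pred N)) ⟩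
    y ⊞ (0 + N)        ≡⟨ ⊞-period y 0 ⟩
    y ⊞ 0              ≡⟨ ⊞-identityʳ y ⟩
    y                  ∎
    where open ≡-Reasoning

  φ-suc : ∀ t p → φ N (suc t) p ≡ pred′ N (φ N t p)
  φ-suc t (a , b) = begin
    (toℕ a + toℕ b + (N ∸ 1 + t * (N ∸ 1))) mod N
      ≡⟨ cong (_mod N) (shift (toℕ a + toℕ b) (N ∸ 1) (t * (N ∸ 1))) ⟩
    (toℕ a + toℕ b + t * (N ∸ 1) + (N ∸ 1)) mod N
      ≡⟨ mod-⊞ (toℕ a + toℕ b + t * (N ∸ 1)) (N ∸ 1) ⟨
    φ N t (a , b) ⊞ (N ∸ 1) ∎
    where
    open ≡-Reasoning
    shift : ∀ u n T → u + (n + T) ≡ u + T + n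
    shift = solve-∀

  φ-right : ∀ t p → φ N t (right N p 1) ≡ φ N t p ⊞ 1
  φ-right t (a , b) = begin
    (toℕ a + toℕ (b ⊞ 1) + T) mod N  ≡⟨ cong (_mod N) (shift (toℕ a) (toℕ (b ⊞ 1)) T) ⟩
    b ⊞ 1 ⊞ (toℕ a + T)              ≡⟨ mod-⊞ (toℕ b + 1) (toℕ a + T) ⟩
    (toℕ b + 1 + (toℕ a + T)) mod N  ≡⟨ cong (_mod N) (swap (toℕ a) (toℕ b) T) ⟩
    (toℕ a + toℕ b + T + 1) mod N    ≡⟨ mod-⊞ (toℕ a + toℕ b + T) 1 ⟨
    φ N t (a , b) ⊞ 1                ∎
    where
    open ≡-Reasoning
    T = t * (N ∸ 1)
    shift : ∀ u v T → u + v + T ≡ v + (u + T)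
    shift = solve-∀
    swap : ∀ u v T → v + 1 + (u + T) ≡ u + v + T + 1
    swap = solve-∀

  φ-up : ∀ t p → φ N t (up N p 1) ≡ φ N t p ⊞ 1
  φ-up t (a , b) = begin
    (toℕ (a ⊞ 1) + toℕ b + T) mod N  ≡⟨ cong (_mod N) (+-assoc (toℕ (a ⊞ 1)) (toℕ b) T) ⟩
    a ⊞ 1 ⊞ (toℕ b + T)              ≡⟨ mod-⊞ (toℕ a + 1) (toℕ b + T) ⟩
    (toℕ a + 1 + (toℕ b + T)) mod N  ≡⟨ cong (_mod N) (swap (toℕ a) (toℕ b) T) ⟩
    (toℕ a + toℕ b + T + 1) mod N    ≡⟨ mod-⊞ (toℕ a + toℕ b + T) 1 ⟨
    φ N t (a , b) ⊞ 1                ∎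
    where
    open ≡-Reasoning
    T = t * (N ∸ 1)
    swap : ∀ u v T → u + 1 + (v + T) ≡ u + v + T + 1
    swap = solve-∀

  φ-suc-step : ∀ t p q → φ N t q ≡ φ N t p ⊞ 1 → φ N (suc t) q ≡ φ N t p
  φ-suc-step t p q q-next = begin
    φ N (suc t) q          ≡⟨ φ-suc t q ⟩
    pred′ N (φ N t q)      ≡⟨ cong (pred′ N) q-next ⟩
    pred′ N (φ N t p ⊞ 1)  ≡⟨ pred′-⊞1 (φ N t p) ⟩
    φ N t p                ∎
    where open ≡-Reasoning

  empty-at : ∀ {m} {Y : Fin m → Fin N} {y l} → (∀ (j : Fin (suc l)) → ¬ InS N Y (y ⊞ toℕ j)) →
             ∀ {j} → j ≤ l → ¬ InS N Y (y ⊞ j)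
  empty-at {Y = Y} {y} empty {j} j≤l =
    subst (λ k → ¬ InS N Y (y ⊞ k)) (toℕ-fromℕ< (s≤s j≤l)) (empty (fromℕ< (s≤s j≤l)))

  bigArc-unique : ∀ {m} (Y : Fin m → Fin N) {y l l′} →
                  BigArc N Y (y , l) → BigArc N Y (y , l′) → l ≡ l′
  bigArc-unique Y {l = l} {l′} (_ , empty , _ , end) (_ , empty′ , _ , end′) with <-cmp l l′
  ... | tri< l<l′ _ _ = contradiction end (empty-at empty′ l<l′)
  ... | tri≈ _ l≡l′ _ = l≡l′
  ... | tri> _ _ l′<l = contradiction end′ (empty-at empty l′<l)

  AdmissibleMove : ∀ {m} (Y Y′ : Fin m → Fin N) → Fin m → Set
  AdmissibleMove Y Y′ i =
    Y′ i ≡ Y i ⊎ (Y′ i ≡ pred′ N (Y i) × (InS N Y (Y i ⊞ 1) ⊎ InS N Y′ (Y i)))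

  module _ {m} {Y Y′ : Fin m → Fin N} (admissible : ∀ i → ¬ ¬ AdmissibleMove Y Y′ i) where

    InS′⇒InS-here-or-next : ∀ {z} → InS N Y′ z → InS N Y z ⊎ InS N Y (z ⊞ 1)
    InS′⇒InS-here-or-next (i , refl) =
      decidable-stable (InS? N Y _ ⊎-dec InS? N Y _) (¬¬-map origin (admissible i))
      where
      origin : AdmissibleMove Y Y′ i → InS N Y (Y′ i) ⊎ InS N Y (Y′ i ⊞ 1)
      origin (inj₁ kept)         = inj₁ (i , sym kept)
      origin (inj₂ (lagged , _)) = inj₂ (i , sym (trans (cong (_⊞ 1) lagged) (⊞1-pred′ (Y i))))

    vacated⇒InS-next×InS′-prev : ∀ {z} → InS N Y z → ¬ InS N Y′ z →
                                 InS N Y (z ⊞ 1) × InS N Y′ (pred′ N z)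
    vacated⇒InS-next×InS′-prev (i , refl) vacated =
      decidable-stable (InS? N Y _ ×-dec InS? N Y′ _) (¬¬-map blocker (admissible i))
      where
      blocker : AdmissibleMove Y Y′ i → InS N Y (Y i ⊞ 1) × InS N Y′ (pred′ N (Y i))
      blocker (inj₁ kept)                 = contradiction (i , kept) vacated
      blocker (inj₂ (_ , inj₂ occupied′)) = contradiction occupied′ vacated
      blocker (inj₂ (lagged , inj₁ next)) = next , (i , lagged)

  module _ {m m′} (Y : Fin m → Fin N) (Y′ : Fin m′ → Fin N)
           (arrived : ∀ {z} → InS N Y′ z → InS N Y z ⊎ InS N Y (z ⊞ 1))
           (vacated : ∀ {z} → InS N Y z → ¬ InS N Y′ z → InS N Y (z ⊞ 1) × InS N Y′ (pred′ N z))
           where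

    bigArc-extends : ∀ {y l} → BigArc N Y′ (y , l) → ∃ λ L → L < N × BigArc N Y (y , L)
    bigArc-extends {y} {l} (1≤l , empty′ , start′ , _) =
      let k , k≤ , hit , below = least-witness (λ j → InS? N Y (y ⊞ j)) start
      in  arc k k≤ hit below
      where
      empty : ∀ {j} → j ≤ l → ¬ InS N Y (y ⊞ j)
      empty {suc j} j<l occupied =
        empty-at empty′ (<⇒≤ j<l) (subst (InS N Y′) (pred′-⊞-suc y j)
          (proj₂ (vacated occupied (empty-at empty′ j<l))))
      -- Label y would be vacated, making y + 1 a label at time t, which the clause above excludes.
      empty {zero} _ occupied = empty {1} 1≤l (subst (InS N Y) (⊞-assoc y 0 1)
        (proj₁ (vacated occupied (empty-at empty′ z≤n))))

      start : InS N Y (y ⊞ (N ∸ 1))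
      start with arrived start′
      ... | inj₁ occupied = occupied
      ... | inj₂ occupied =
        contradiction (subst (InS N Y) (trans (⊞1-pred′ y) (sym (⊞-identityʳ y))) occupied) (empty z≤n)

      arc : ∀ k → k ≤ N ∸ 1 → InS N Y (y ⊞ k) → (∀ {j} → j < k → ¬ InS N Y (y ⊞ j)) →
            ∃ λ L → L < N × BigArc N Y (y , L)
      arc zero    _   hit _     = contradiction hit (empty z≤n)
      arc (suc L) k≤ hit below =
        L , ≤-trans k≤ (m∸n≤m N 1) , ≤-trans 1≤l l≤L , (λ j → below (toℕ<n j)) , start , hit
        where
        l≤L : l ≤ L
        l≤L = ≮⇒≥ (λ L<l → empty L<l hit)

    numBigArcs-mono : numBigArcs N Y′ ≤ numBigArcs N Y
    numBigArcs-mono =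
      length-filter-cartesianProduct-mono (BigArc? N Y′) (BigArc? N Y) (allFin N) (upTo N) λ y →
        length-filter-subsingleton-≤ (λ l → BigArc? N Y′ (y , l)) (λ l → BigArc? N Y (y , l))
          (upTo⁺ N) (bigArc-unique Y′)
          (λ arc′ → let L , L<N , arc = bigArc-extends arc′ in lose (∈-upTo⁺ L<N) arc)

  module _ {m} (col : Fin m → Colour) where

    blueBlocked⇒ahead : ∀ {w p} → BlueBlocked N col w p → ∃ λ c → HasAt N col w c (right N p 1)
    blueBlocked⇒ahead (zero  , _     , red-ahead) = red , red-ahead
    blueBlocked⇒ahead (suc _ , blues , _)         = blue , blues 0 (s≤s z≤n)

    redBlocked⇒ahead : ∀ {w p} → RedBlocked N col w p →
                       HasAt N col w blue (up N p 1) ⊎ HasAt N col w red (up N p 1)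
    redBlocked⇒ahead (zero  , _    , blue-ahead) = inj₁ blue-ahead
    redBlocked⇒ahead (suc _ , reds , _)          = inj₂ (reds 0 (s≤s z≤n))

  module _ {m} (col : Fin m → Colour) {x z x′ : Fin m → Pos N}
           (blue-step : BlueStep N col x z) (red-step : RedStep N col z x′) (t : ℕ) where

    private
      Y Y′ : Fin m → Fin N
      Y  i = φ N t (x i)
      Y′ i = φ N (suc t) (x′ i)

    red-waits : ∀ {i} → col i ≡ red → z i ≡ x i
    red-waits {i} = proj₁ (blue-step i)

    blue-waits : ∀ {i} → col i ≡ blue → x′ i ≡ z i
    blue-waits {i} = proj₁ (red-step i)

    occupied⇒InS : ∀ {c q w} → HasAt N col x c q → φ N t q ≡ w → InS N Y w
    occupied⇒InS (j , _ , refl) refl = j , refl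

    occupied′⇒InS′ : ∀ {c q w} → HasAt N col x′ c q → φ N (suc t) q ≡ w → InS N Y′ w
    occupied′⇒InS′ (j , _ , refl) refl = j , refl

    stayed⇒lagged : ∀ {i} → x′ i ≡ x i → Y′ i ≡ pred′ N (Y i)
    stayed⇒lagged {i} stayed = trans (cong (φ N (suc t)) stayed) (φ-suc t (x i))

    advanced⇒kept : ∀ {i q} → x′ i ≡ q → φ N t q ≡ Y i ⊞ 1 → Y′ i ≡ Y i
    advanced⇒kept {i} {q} advanced q-next =
      trans (cong (φ N (suc t)) advanced) (φ-suc-step t (x i) q q-next)

    blue-admissible : ∀ {i} → col i ≡ blue → Dec (BlueBlocked N col x (x i)) → AdmissibleMove Y Y′ i
    blue-admissible {i} c (yes blocked) =
      inj₂ (stayed⇒lagged (trans (blue-waits c) (proj₁ (proj₂ (blue-step i) c) blocked)) ,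
            inj₁ (occupied⇒InS (proj₂ (blueBlocked⇒ahead col blocked)) (φ-right t (x i))))
    blue-admissible {i} c (no free) =
      inj₁ (advanced⇒kept (trans (blue-waits c) (proj₂ (proj₂ (blue-step i) c) free))
                          (φ-right t (x i)))

    red-admissible : ∀ {i} → col i ≡ red → Dec (RedBlocked N col z (z i)) → AdmissibleMove Y Y′ i
    red-admissible {i} c (yes blocked) =
      inj₂ (stayed⇒lagged (trans (proj₁ (proj₂ (red-step i) c) blocked) (red-waits c)) ,
            ahead (redBlocked⇒ahead col blocked))
      where
      above : φ N t (up N (z i) 1) ≡ Y i ⊞ 1
      above = trans (cong (λ p → φ N t (up N p 1)) (red-waits c)) (φ-up t (x i))

      -- A blue car in front has already made its move, so it sits at up (x i) 1 at time t + 1.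
      ahead : HasAt N col z blue (up N (z i) 1) ⊎ HasAt N col z red (up N (z i) 1) →
              InS N Y (Y i ⊞ 1) ⊎ InS N Y′ (Y i)
      ahead (inj₁ (j , cj , zj≡)) =
        inj₂ (occupied′⇒InS′ (j , cj , trans (blue-waits cj) zj≡)
                             (φ-suc-step t (x i) (up N (z i) 1) above))
      ahead (inj₂ (j , cj , zj≡)) =
        inj₁ (occupied⇒InS (j , cj , trans (sym (red-waits cj)) zj≡) above)
    red-admissible {i} c (no free) =
      inj₁ (advanced⇒kept (trans (proj₂ (proj₂ (red-step i) c) free)
                                 (cong (λ p → up N p 1) (red-waits c)))
                          (φ-up t (x i)))

    -- Being blocked quantifies over all k and is not decidable as stated, so the case split is
    -- made under ¬ ¬; the consequences drawn from it are decidable, hence stable.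
    admissible : ∀ i → ¬ ¬ AdmissibleMove Y Y′ i
    admissible i with col i in c
    ... | blue = ¬¬-map (blue-admissible c) ¬¬-excluded-middle
    ... | red  = ¬¬-map (red-admissible c) ¬¬-excluded-middle

    numBigArcs-step : numBigArcs N Y′ ≤ numBigArcs N Y
    numBigArcs-step =
      numBigArcs-mono Y Y′ (InS′⇒InS-here-or-next admissible) (vacated⇒InS-next×InS′-prev admissible)

lemma3 : (N m : ℕ) .{{_ : NonZero N}} → m < N * N →
         (col : Fin m → Colour) (X : ℕ → Fin m → Pos N) →
         Injective _≡_ _≡_ (X 0) → IsTrajectory N col X →
         ∀ s t → s ≤ t → numBigArcs N (Ys N X t) ≤ numBigArcs N (Ys N X s)
lemma3 N m _ col X _ trajectory s t = antitone-from-steps (λ t → numBigArcs N (Ys N X t)) step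
  where
  step : ∀ t → numBigArcs N (Ys N X (suc t)) ≤ numBigArcs N (Ys N X t)
  step t = let _ , blue-step , red-step = trajectory t in numBigArcs-step col blue-step red-step t
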